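{- Let $T$ be a text of length $n$ and $\mathcal{S}=\{S: S\text{ a substring of }T,\ \phi(S)>0\}$. Then $\sum_{S\in\mathcal{S}}\phi(S)\le n$ and $|\mathcal{S}|\le n$.
   Context: With $f(W)$ the number of occurrences of $W$ in $T$, an occurrence $(s,e)$, $1\le s\le e\le n$, is a net occurrence if $f(T[s\ldots e])\ge 2$, $f(T[s-1\ldots e])=1$ and $f(T[s\ldots e+1])=1$, where the second condition is considered true when $s=1$ and the third when $e=n$. The net frequency $\phi(S)$ is the number of net occurrences $(s,e)$ with $T[s\ldots e]=S$. -}

module Defs where

open import Data.Bool using (Bool; true; false; _∧_; _∨_; not)
open import Data.Nat using (ℕ; zero; suc; _+_; _∸_; _≤ᵇ_; _≡ᵇ_; _<ᵇ_)
open import Data.List using (List; []; _∷_; length; take; drop; filterᵇ; upTo; concatMap; map; deduplicate)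
open import Data.List.Properties using (≡-dec)
open import Data.Product using (_×_; _,_)
open import Relation.Binary.Definitions using (DecidableEquality)
open import Relation.Nullary.Decidable using (⌊_⌋)

-- Text T over an alphabet A with decidable equality; n = length T.
-- Positions are 0-indexed: paper position p (1..n) is index p-1 here.
module _ {A : Set} (_≟_ : DecidableEquality A) (T : List A) where

  n : ℕ
  n = length T

  _≟L_ : DecidableEquality (List A)
  _≟L_ = ≡-dec _≟_

  slice : ℕ → ℕ → List A
  slice s len = take len (drop s T)

  occursAt : List A → ℕ → Bool
  occursAt W i = ((i + length W) ≤ᵇ n) ∧ ⌊ slice i (length W) ≟L W ⌋

  freq : List A → ℕ
  freq W = length (filterᵇ (occursAt W) (upTo n))

  sub : ℕ → ℕ → List A
  sub s e = slice s (suc e ∸ s)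

  occurrences : List (ℕ × ℕ)
  occurrences = concatMap (λ e → map (λ s → (s , e)) (upTo (suc e))) (upTo n)

  isNet : ℕ × ℕ → Bool
  isNet (s , e) =
    (2 ≤ᵇ freq (sub s e))
    ∧ (leftOk s)
    ∧ ((suc e ≡ᵇ n) ∨ (freq (sub s (suc e)) ≡ᵇ 1))
    where
      leftOk : ℕ → Bool
      leftOk zero = true
      leftOk (suc s') = freq (sub s' e) ≡ᵇ 1

  φ : List A → ℕ
  φ S = length (filterᵇ (λ p → isNet p ∧ ⌊ sub (Data.Product.proj₁ p) (Data.Product.proj₂ p) ≟L S ⌋) occurrences)

  substrings : List (List A)
  substrings = map (λ p → sub (Data.Product.proj₁ p) (Data.Product.proj₂ p)) occurrences

  𝒮 : List (List A)
  𝒮 = deduplicate _≟L_ (filterᵇ (λ S → 0 <ᵇ φ S) substrings)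

{-# OPTIONS --safe #-}
module Submission where

-- At most one net occurrence ends at any position e: if (s, e) and (s′, e) with s < s′ were
-- both net, then T[s′-1..e] would be a suffix of the repeated word T[s..e], hence repeated
-- itself, contradicting f(T[s′-1..e]) = 1.  So there are at most n net occurrences, and
-- grouping them by the word they spell gives Σ φ ≤ n; every S ∈ 𝒮 contributes φ(S) ≥ 1.

open import Defs
open import Data.Nat using (ℕ; _≤_)
open import Data.List using (List; length; map)
open import Data.Nat.ListAction using (sum)
open import Data.Product using (_×_)
open import Relation.Binary.Definitions using (DecidableEquality)

open import Data.Bool using (Bool; true; false; T; not; _∧_)
open import Data.Bool.Properties using (T-∧; T-≡)
open import Data.Nat using (zero; suc; _+_; _∸_; _⊓_; _<_; z≤n; s≤s; z<s; _≤ᵇ_; _<ᵇ_)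
open import Data.Nat.Properties
open import Data.List using ([]; _∷_; _++_; take; drop; filterᵇ; applyUpTo; upTo; concatMap)
open import Data.List.Properties
  using (length-++; filter-++; filter-≐; filter-some; take-[]; drop-drop; length-take; length-drop;
         length-upTo; map-applyUpTo; map-cong-local; ≡-dec)
open import Data.List.Relation.Unary.All as All using (All; []; _∷_)
open import Data.List.Relation.Unary.All.Properties using (all-filter; applyUpTo⁺₁; deduplicate⁺)
open import Data.List.Relation.Unary.Any.Properties using (applyUpTo⁺)
open import Data.List.Relation.Unary.AllPairs using ([]; _∷_)
open import Data.List.Relation.Unary.Unique.Propositional using (Unique)
open import Data.List.Relation.Unary.Unique.DecPropositional.Properties using (deduplicate-!)
open import Data.Product using (∃-syntax; _,_; proj₁; proj₂; uncurry)
open import Function using (_∘_; id; Equivalence)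
open import Data.Empty using (⊥-elim)
open import Relation.Nullary using (¬_)
open import Relation.Nullary.Decidable using (⌊_⌋; T?; yes; no; toWitness; fromWitness)
open import Relation.Binary.PropositionalEquality

count : {X : Set} → (X → Bool) → List X → ℕ
count p xs = length (filterᵇ p xs)

count-cong : {X : Set} {p q : X → Bool} → p ≗ q → ∀ xs → count p xs ≡ count q xs
count-cong {p = p} {q} p≗q xs =
  cong length (filter-≐ (T? ∘ p) (T? ∘ q) (subst T (p≗q _) , subst T (sym (p≗q _))) xs)

module _ {X : Set} (p : X → Bool) where

  count-++ : ∀ xs ys → count p (xs ++ ys) ≡ count p xs + count p ys
  count-++ xs ys = trans (cong length (filter-++ (T? ∘ p) xs ys)) (length-++ (filterᵇ p xs))

  count-concatMap≤length : {Y : Set} (h : Y → List X) {ys : List Y} →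
                           All (λ y → count p (h y) ≤ 1) ys → count p (concatMap h ys) ≤ length ys
  count-concatMap≤length h [] = z≤n
  count-concatMap≤length h {y ∷ ys} (hy≤1 ∷ hys≤1) = begin
    count p (h y ++ concatMap h ys)           ≡⟨ count-++ (h y) (concatMap h ys) ⟩
    count p (h y) + count p (concatMap h ys)  ≤⟨ +-mono-≤ hy≤1 (count-concatMap≤length h hys≤1) ⟩
    suc (length ys)                           ∎
    where open ≤-Reasoning

  count-∧+count-∧-not : ∀ (q : X → Bool) xs →
                        count (λ x → p x ∧ q x) xs + count (λ x → p x ∧ not (q x)) xs ≡ count p xs
  count-∧+count-∧-not q [] = refl
  count-∧+count-∧-not q (x ∷ xs) with p x | q x
  ... | false | _     = count-∧+count-∧-not q xs
  ... | true  | true  = cong suc (count-∧+count-∧-not q xs)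
  ... | true  | false = trans (+-suc _ _) (cong suc (count-∧+count-∧-not q xs))

  hit⇒1≤count : ∀ F {m i} → i < m → T (p (F i)) → 1 ≤ count p (applyUpTo F m)
  hit⇒1≤count F i<m hit = filter-some (T? ∘ p) (applyUpTo⁺ F hit i<m)

  hits⇒2≤count : ∀ F {m i j} → i < j → j < m → T (p (F i)) → T (p (F j)) → 2 ≤ count p (applyUpTo F m)
  hits⇒2≤count F {suc m} {zero} {suc j} _ (s≤s j<m) hitᵢ hitⱼ with p (F 0)
  ... | true  = s≤s (hit⇒1≤count (F ∘ suc) j<m hitⱼ)
  ... | false = ⊥-elim hitᵢ
  hits⇒2≤count F {suc m} {suc i} {suc j} (s≤s i<j) (s≤s j<m) hitᵢ hitⱼ with p (F 0)
  ... | true  = m≤n⇒m≤1+n (hits⇒2≤count (F ∘ suc) i<j j<m hitᵢ hitⱼ)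
  ... | false = hits⇒2≤count (F ∘ suc) i<j j<m hitᵢ hitⱼ

  1≤count⇒hit : ∀ F m → 1 ≤ count p (applyUpTo F m) → ∃[ i ] i < m × T (p (F i))
  1≤count⇒hit F (suc m) 1≤c with p (F 0) in hit
  ... | true  = 0 , z<s , Equivalence.from T-≡ hit
  ... | false with i , i<m , hitᵢ ← 1≤count⇒hit (F ∘ suc) m 1≤c = suc i , s≤s i<m , hitᵢ

  2≤count⇒hits : ∀ F m → 2 ≤ count p (applyUpTo F m) →
                 ∃[ i ] ∃[ j ] i < j × j < m × T (p (F i)) × T (p (F j))
  2≤count⇒hits F (suc m) 2≤c with p (F 0) in hit
  2≤count⇒hits F (suc m) (s≤s 1≤c) | true
    with j , j<m , hitⱼ ← 1≤count⇒hit (F ∘ suc) m 1≤c =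
    0 , suc j , z<s , s≤s j<m , Equivalence.from T-≡ hit , hitⱼ
  ... | false with i , j , i<j , j<m , hitᵢ , hitⱼ ← 2≤count⇒hits (F ∘ suc) m 2≤c =
    suc i , suc j , s≤s i<j , s≤s j<m , hitᵢ , hitⱼ

length≤sum : {X : Set} (f : X → ℕ) {xs : List X} → All (λ x → 1 ≤ f x) xs → length xs ≤ sum (map f xs)
length≤sum f [] = z≤n
length≤sum f (1≤fx ∷ 1≤fxs) = +-mono-≤ 1≤fx (length≤sum f 1≤fxs)

module _ {X B : Set} (_≟B_ : DecidableEquality B) (label : X → B) where

  labelled : (X → Bool) → B → X → Bool
  labelled p S x = p x ∧ ⌊ label x ≟B S ⌋

  notLabelled : (X → Bool) → B → X → Bool
  notLabelled p S x = p x ∧ not ⌊ label x ≟B S ⌋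

  labelled-notLabelled : ∀ p {S S′} → S ≢ S′ → labelled p S′ ≗ labelled (notLabelled p S) S′
  labelled-notLabelled p {S} {S′} S≢S′ x with p x | label x ≟B S′ | label x ≟B S
  ... | false | _        | _        = refl
  ... | true  | yes refl | yes refl = ⊥-elim (S≢S′ refl)
  ... | true  | yes _    | no _     = refl
  ... | true  | no _     | yes _    = refl
  ... | true  | no _     | no _     = refl

  sum-count-labelled≤count : ∀ p {Ss} → Unique Ss → ∀ xs →
                             sum (map (λ S → count (labelled p S) xs) Ss) ≤ count p xs
  sum-count-labelled≤count p [] xs = z≤n
  sum-count-labelled≤count p {S ∷ Ss} (S∉Ss ∷ Ss!) xs = begin
    count (labelled p S) xs + sum (map (λ S′ → count (labelled p S′) xs) Ss)
      ≡⟨ cong (λ cs → count (labelled p S) xs + sum cs) (map-cong-local (All.map relabel S∉Ss)) ⟩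
    count (labelled p S) xs + sum (map (λ S′ → count (labelled (notLabelled p S) S′) xs) Ss)
      ≤⟨ +-monoʳ-≤ _ (sum-count-labelled≤count (notLabelled p S) Ss! xs) ⟩
    count (labelled p S) xs + count (notLabelled p S) xs
      ≡⟨ count-∧+count-∧-not p (λ x → ⌊ label x ≟B S ⌋) xs ⟩
    count p xs ∎
    where
      open ≤-Reasoning
      relabel : ∀ {S′} → S ≢ S′ → count (labelled p S′) xs ≡ count (labelled (notLabelled p S) S′) xs
      relabel S≢S′ = count-cong (labelled-notLabelled p S≢S′) xs

drop-take : {X : Set} (k m : ℕ) (xs : List X) → drop k (take m xs) ≡ take (m ∸ k) (drop k xs)
drop-take zero    m       xs       = refl
drop-take (suc k) zero    xs       = refl
drop-take (suc k) (suc m) []       = sym (take-[] (m ∸ k))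
drop-take (suc k) (suc m) (x ∷ xs) = drop-take k m xs

module _ {A : Set} (_≟_ : DecidableEquality A) (text : List A) where

  occursAt⁻ : ∀ W i → T (occursAt _≟_ text W i) →
              i + length W ≤ length text × slice _≟_ text i (length W) ≡ W
  occursAt⁻ W i occ = Data.Product.map (≤ᵇ⇒≤ _ _) toWitness (Equivalence.to T-∧ occ)

  occursAt⁺ : ∀ W i → i + length W ≤ length text → slice _≟_ text i (length W) ≡ W →
              T (occursAt _≟_ text W i)
  occursAt⁺ W i fits matches = Equivalence.from T-∧ (≤⇒≤ᵇ fits , fromWitness matches)

  slice-drop : ∀ s k len → slice _≟_ text (s + k) (len ∸ k) ≡ drop k (slice _≟_ text s len)
  slice-drop s k len = begin
    take (len ∸ k) (drop (s + k) text)     ≡⟨ cong (take (len ∸ k)) (drop-drop s k text) ⟨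
    take (len ∸ k) (drop k (drop s text))  ≡⟨ drop-take k len (drop s text) ⟨
    drop k (take len (drop s text))        ∎
    where open ≡-Reasoning

  occursAt-drop : ∀ W i {k} → k ≤ length W → T (occursAt _≟_ text W i) →
                  T (occursAt _≟_ text (drop k W) (i + k))
  occursAt-drop W i {k} k≤|W| occ = occursAt⁺ (drop k W) (i + k) fits matches
    where
      shifted-end : i + k + length (drop k W) ≡ i + length W
      shifted-end = begin
        i + k + length (drop k W)   ≡⟨ cong (i + k +_) (length-drop k W) ⟩
        i + k + (length W ∸ k)      ≡⟨ +-assoc i k _ ⟩
        i + (k + (length W ∸ k))    ≡⟨ cong (i +_) (m+[n∸m]≡n k≤|W|) ⟩
        i + length W                ∎
        where open ≡-Reasoning
      fits : i + k + length (drop k W) ≤ length text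
      fits = subst (_≤ length text) (sym shifted-end) (proj₁ (occursAt⁻ W i occ))
      matches : slice _≟_ text (i + k) (length (drop k W)) ≡ drop k W
      matches = begin
        slice _≟_ text (i + k) (length (drop k W))  ≡⟨ cong (slice _≟_ text (i + k)) (length-drop k W) ⟩
        slice _≟_ text (i + k) (length W ∸ k)       ≡⟨ slice-drop i k (length W) ⟩
        drop k (slice _≟_ text i (length W))        ≡⟨ cong (drop k) (proj₂ (occursAt⁻ W i occ)) ⟩
        drop k W                                    ∎
        where open ≡-Reasoning

  2≤freq-drop : ∀ W {k} → k < length W → 2 ≤ freq _≟_ text W → 2 ≤ freq _≟_ text (drop k W)
  2≤freq-drop W {k} k<|W| 2≤f
    with i , j , i<j , j<n , occᵢ , occⱼ ← 2≤count⇒hits (occursAt _≟_ text W) id (length text) 2≤f =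
    hits⇒2≤count (occursAt _≟_ text (drop k W)) id (+-monoˡ-< k i<j) j+k<n
      (occursAt-drop W i (<⇒≤ k<|W|) occᵢ) (occursAt-drop W j (<⇒≤ k<|W|) occⱼ)
    where
      j+k<n : j + k < length text
      j+k<n = <-≤-trans (+-monoʳ-< j k<|W|) (proj₁ (occursAt⁻ W j occⱼ))

  sub-drop : ∀ s k e → sub _≟_ text (s + k) e ≡ drop k (sub _≟_ text s e)
  sub-drop s k e =
    trans (cong (slice _≟_ text (s + k)) (sym (∸-+-assoc (suc e) s k))) (slice-drop s k (suc e ∸ s))

  length-sub : ∀ s {e} → e < length text → length (sub _≟_ text s e) ≡ suc e ∸ s
  length-sub s {e} e<n = begin
    length (take (suc e ∸ s) (drop s text))  ≡⟨ length-take (suc e ∸ s) (drop s text) ⟩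
    (suc e ∸ s) ⊓ length (drop s text)       ≡⟨ cong ((suc e ∸ s) ⊓_) (length-drop s text) ⟩
    (suc e ∸ s) ⊓ (length text ∸ s)          ≡⟨ m≤n⇒m⊓n≡m (∸-monoˡ-≤ s e<n) ⟩
    suc e ∸ s                                ∎
    where open ≡-Reasoning

  2≤freq-sub-suffix : ∀ {s t e} → s ≤ t → t ≤ e → e < length text →
                      2 ≤ freq _≟_ text (sub _≟_ text s e) → 2 ≤ freq _≟_ text (sub _≟_ text t e)
  2≤freq-sub-suffix {s} {t} {e} s≤t t≤e e<n 2≤f =
    subst (λ W → 2 ≤ freq _≟_ text W) suffix (2≤freq-drop (sub _≟_ text s e) t∸s<len 2≤f)
    where
      suffix : drop (t ∸ s) (sub _≟_ text s e) ≡ sub _≟_ text t e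
      suffix = trans (sym (sub-drop s (t ∸ s) e)) (cong (λ u → sub _≟_ text u e) (m+[n∸m]≡n s≤t))
      t∸s<len : t ∸ s < length (sub _≟_ text s e)
      t∸s<len = subst (t ∸ s <_) (sym (length-sub s e<n)) (∸-monoˡ-< (s≤s t≤e) s≤t)

  net⇒2≤freq : ∀ {s e} → T (isNet _≟_ text (s , e)) → 2 ≤ freq _≟_ text (sub _≟_ text s e)
  net⇒2≤freq net = ≤ᵇ⇒≤ 2 _ (proj₁ (Equivalence.to T-∧ net))

  net⇒freq-extendˡ≡1 : ∀ {s e} → T (isNet _≟_ text (suc s , e)) → freq _≟_ text (sub _≟_ text s e) ≡ 1
  net⇒freq-extendˡ≡1 {s} {e} net =
    ≡ᵇ⇒≡ _ 1 (proj₁ (Equivalence.to T-∧ (proj₂ (Equivalence.to (T-∧ {x = repeated}) net))))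
    where
      repeated : Bool
      repeated = 2 ≤ᵇ freq _≟_ text (sub _≟_ text (suc s) e)

  count-net-endingAt≤1 : ∀ {e} → e < length text →
                         count (isNet _≟_ text) (map (λ s → s , e) (upTo (suc e))) ≤ 1
  count-net-endingAt≤1 {e} e<n =
    subst (λ ps → count (isNet _≟_ text) ps ≤ 1) (sym (map-applyUpTo id (λ s → s , e) (suc e)))
          (≮⇒≥ no-two)
    where
      no-two : ¬ 2 ≤ count (isNet _≟_ text) (applyUpTo (λ s → s , e) (suc e))
      no-two 2≤c with 2≤count⇒hits (isNet _≟_ text) (λ s → s , e) (suc e) 2≤c
      ... | _ , zero  , () , _
      ... | i , suc t , s≤s i≤t , s≤s t<e , netᵢ , netₜ =
        <-irrefl refl (subst (2 ≤_) (net⇒freq-extendˡ≡1 {t} netₜ)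
                               (2≤freq-sub-suffix i≤t (<⇒≤ t<e) e<n (net⇒2≤freq {i} netᵢ)))

  count-net≤length : count (isNet _≟_ text) (occurrences _≟_ text) ≤ length text
  count-net≤length =
    subst (count (isNet _≟_ text) (occurrences _≟_ text) ≤_) (length-upTo (length text))
      (count-concatMap≤length (isNet _≟_ text) _ (applyUpTo⁺₁ id (length text) count-net-endingAt≤1))

lemma22 : {A : Set} (_≟_ : DecidableEquality A) (T : List A) →
    (sum (map (φ _≟_ T) (𝒮 _≟_ T)) ≤ length T) × (length (𝒮 _≟_ T) ≤ length T)
lemma22 {A} _≟_ text = Σφ≤n , ≤-trans |𝒮|≤Σφ Σφ≤n
  where
    φ>0 : List A → Bool
    φ>0 S = 0 <ᵇ φ _≟_ text S
    Σφ≤n : sum (map (φ _≟_ text) (𝒮 _≟_ text)) ≤ length text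
    Σφ≤n = ≤-trans
      (sum-count-labelled≤count (≡-dec _≟_) (uncurry (sub _≟_ text)) (isNet _≟_ text)
        (deduplicate-! (≡-dec _≟_) (filterᵇ φ>0 (substrings _≟_ text))) (occurrences _≟_ text))
      (count-net≤length _≟_ text)
    |𝒮|≤Σφ : length (𝒮 _≟_ text) ≤ sum (map (φ _≟_ text) (𝒮 _≟_ text))
    |𝒮|≤Σφ = length≤sum (φ _≟_ text)
      (All.map (<ᵇ⇒< 0 _) (deduplicate⁺ (≡-dec _≟_) (all-filter (T? ∘ φ>0) (substrings _≟_ text))))
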